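{- Let $a,b$ be relatively prime integers with $1<a<b$, let $S=\langle a,b\rangle$, let $(u,v)$ be the definitely least solution of $ax+by=1$, and let $h=\min I(S)$. Then \[I(S)=\{\,h+(i-1)b+(j-1)a \;:\; 1\le i\le |v|,\ 1\le j\le |u|\,\},\] that is, $I(S)=\{h,\dots,h+(|u|-1)a\}\cup\{h+b,\dots,h+b+(|u|-1)a\}\cup\cdots\cup\{h+(|v|-1)b,\dots,h+(|v|-1)b+(|u|-1)a\}$.
   Context: $\mathbb{N}$ denotes the nonnegative integers and $\langle a,b\rangle=\{\lambda_1a+\lambda_2b:\lambda_1,\lambda_2\in\mathbb{N}\}$. An isolated gap of a numerical semigroup $S$ is an element $x\in\mathbb{N}\setminus S$ with $x-1,x+1\in S$; $I(S)$ is the set of isolated gaps. A solution $(u,v)\in\mathbb{Z}^2$ of $ax+by=1$ is the definitely least solution if both $|u|$ and $|v|$ attain their least possible values among all integer solutions; it is unique, and is the unique solution with $|u|\le b/2$, $|v|\le a/2$. -}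

module Defs where

open import Data.Nat using (ℕ; suc; _+_; _*_; _≤_)
open import Data.Integer as ℤ using (ℤ; +_; ∣_∣)
open import Data.Product using (Σ; ∃; _×_)
open import Relation.Binary.PropositionalEquality using (_≡_)
open import Relation.Nullary using (¬_)

_∈⟨_,_⟩ : ℕ → ℕ → ℕ → Set
x ∈⟨ a , b ⟩ = ∃ λ (l₁ : ℕ) → ∃ λ (l₂ : ℕ) → x ≡ l₁ * a + l₂ * b

IsolatedGap : ℕ → ℕ → ℕ → Set
IsolatedGap a b x =
  ¬ (x ∈⟨ a , b ⟩) ×
  (∃ λ y → suc y ≡ x × y ∈⟨ a , b ⟩) ×
  (suc x ∈⟨ a , b ⟩)

IsSolution : ℕ → ℕ → ℤ → ℤ → Set
IsSolution a b u v = (+ a) ℤ.* u ℤ.+ (+ b) ℤ.* v ≡ + 1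

IsDefinitelyLeast : ℕ → ℕ → ℤ → ℤ → Set
IsDefinitelyLeast a b u v =
  IsSolution a b u v ×
  (∀ (u' v' : ℤ) → IsSolution a b u' v' → ∣ u ∣ ≤ ∣ u' ∣ × ∣ v ∣ ≤ ∣ v' ∣)

IsMinIsolatedGap : ℕ → ℕ → ℕ → Set
IsMinIsolatedGap a b h = IsolatedGap a b h × (∀ x → IsolatedGap a b x → h ≤ x)

{-# OPTIONS --safe #-}
-- Up to swapping a and b, the definitely least solution is (U , -V) with a U = 1 + b V,
-- 2U ≤ b and 2V ≤ a; write b = 2U + c and a = 2V + d, so that h = c a + 1 satisfies
-- h + 1 = d b. For q < V and j < U the point x = h + q b + j a has x - 1 = (c + j) a + q b
-- and x + 1 = j a + (q + d) b in S, while x + V b = (c + j + U) a + q b with c + j + U < b: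
-- by coprimality any representation of x would push that coefficient of a up to at least b.
-- Conversely, let x be an isolated gap with x - 1 = p a + q b. Then q < V, else
-- x = (p + U) a + (q - V) b; comparing x + 1 + 2V b = (p + 2U) a + q b with a representation
-- of x + 1 gives p ≥ c by the same coprimality argument; and p - c < U, else trading b copies
-- of a for a copies of b represents x.
module Submission where

open import Defs
open import Data.Nat using (ℕ; zero; suc; _+_; _*_; _∸_; _≤_; _<_; _≤?_; z<s)
open import Data.Nat.Properties
open import Data.Nat.Coprimality using (Coprime; coprime-divisor)
import Data.Nat.Coprimality as Coprime
open import Data.Nat.Divisibility using (divides; ∣⇒≤)
open import Data.Nat.Tactic.RingSolver using (solve)
open import Algebra.Properties.CommutativeSemigroup +-commutativeSemigroup using (xy∙z≈xz∙y)
open import Data.Integer as ℤ using (ℤ; +_; -[1+_]; ∣_∣; _⊖_)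
import Data.Integer.Properties as ℤP
import Data.Integer.Tactic.RingSolver as ℤ-Solver
open import Data.List using (_∷_; [])
open import Data.Product using (Σ; ∃; _×_; _,_; proj₁; proj₂; swap)
open import Data.Sum using (_⊎_; inj₁; inj₂; [_,_]′)
open import Function.Base using (_∘_)
open import Function.Bundles using (_⇔_; mk⇔; Equivalence)
open import Relation.Nullary using (¬_; yes; no; contradiction)
open import Relation.Binary.PropositionalEquality
  using (_≡_; _≢_; refl; sym; trans; cong; cong₂; subst; module ≡-Reasoning)

open ≡-Reasoning

∈⟨⟩-comm : ∀ {a b x} → x ∈⟨ a , b ⟩ → x ∈⟨ b , a ⟩
∈⟨⟩-comm {a} {b} (l₁ , l₂ , x≡) = l₂ , l₁ , trans x≡ (+-comm (l₁ * a) (l₂ * b))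

IsolatedGap-comm : ∀ {a b x} → IsolatedGap a b x → IsolatedGap b a x
IsolatedGap-comm (x∉S , (y , y+1≡x , y∈S) , x+1∈S) =
  x∉S ∘ ∈⟨⟩-comm , (y , y+1≡x , ∈⟨⟩-comm y∈S) , ∈⟨⟩-comm x+1∈S

IsMinIsolatedGap-comm : ∀ {a b h} → IsMinIsolatedGap a b h → IsMinIsolatedGap b a h
IsMinIsolatedGap-comm (gap , minimal) = IsolatedGap-comm gap , λ x → minimal x ∘ IsolatedGap-comm

Grid : (a b h m n x : ℕ) → Set
Grid a b h m n x = ∃ λ i → ∃ λ j → (1 ≤ i × i ≤ m) × (1 ≤ j × j ≤ n) ×
  x ≡ h + (i ∸ 1) * b + (j ∸ 1) * a

Grid-comm : ∀ {a b h m n x} → Grid a b h m n x → Grid b a h n m x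
Grid-comm {h = h} (i , j , i∈ , j∈ , refl) = j , i , j∈ , i∈ , xy∙z≈xz∙y h _ _

IsolatedGapsGrid : (a b m n : ℕ) → Set
IsolatedGapsGrid a b m n =
  Σ ℕ λ h → IsMinIsolatedGap a b h × (∀ x → IsolatedGap a b x ⇔ Grid a b h m n x)

IsolatedGapsGrid-comm : ∀ {a b m n} → IsolatedGapsGrid b a n m → IsolatedGapsGrid a b m n
IsolatedGapsGrid-comm (h , min , iff) = h , IsMinIsolatedGap-comm min , λ x →
  mk⇔ (Grid-comm ∘ Equivalence.to (iff x) ∘ IsolatedGap-comm)
      (IsolatedGap-comm ∘ Equivalence.from (iff x) ∘ Grid-comm)

[1+e]*b≡f*a⇒b≤f : ∀ {a b} e f → Coprime a b → suc e * b ≡ f * a → b ≤ f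
[1+e]*b≡f*a⇒b≤f {b = b} e zero    _       [1+e]b≡0  = ≤-reflexive (m+n≡0⇒m≡0 b [1+e]b≡0)
[1+e]*b≡f*a⇒b≤f {a}     e (suc f) coprime [1+e]b≡fa =
  ∣⇒≤ (coprime-divisor (Coprime.sym coprime)
         (divides (suc e) (trans (*-comm a (suc f)) (sym [1+e]b≡fa))))

coprime-exchange : ∀ {a b q t} n m → Coprime a b → 0 < b → q < t →
                   n * a + t * b ≡ m * a + q * b → n + b ≤ m
coprime-exchange {a} {b} {q} n m coprime 0<b q<t eq with m≤n⇒∃[o]m+o≡n q<t
... | e , refl = compare (≤-total n m)
  where
  shifted : n * a + suc e * b ≡ m * a
  shifted = +-cancelʳ-≡ (q * b) _ _ (begin
    n * a + suc e * b + q * b  ≡⟨ solve (n ∷ a ∷ e ∷ b ∷ q ∷ []) ⟩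
    n * a + (suc q + e) * b    ≡⟨ eq ⟩
    m * a + q * b              ∎)

  compare : n ≤ m ⊎ m ≤ n → n + b ≤ m
  compare (inj₁ n≤m) with m≤n⇒∃[o]m+o≡n n≤m
  ... | f , refl =
    +-monoʳ-≤ n ([1+e]*b≡f*a⇒b≤f e f coprime
      (+-cancelˡ-≡ (n * a) _ _ (trans shifted (*-distribʳ-+ a n f))))
  compare (inj₂ m≤n) = contradiction (sym shifted)
    (<⇒≢ (≤-<-trans (*-monoˡ-≤ a m≤n) (m<m+n (n * a) (≤-trans 0<b (m≤m+n b (e * b))))))

module IsolatedGapsOfLeastSolution
  {a b U V c d : ℕ} (coprime : Coprime a b) (0<U : 0 < U) (0<V : 0 < V)
  (bezout : a * U ≡ 1 + b * V) (U+U+c≡b : U + U + c ≡ b) (V+V+d≡a : V + V + d ≡ a) where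

  h : ℕ
  h = suc (c * a)

  0<b : 0 < b
  0<b = subst (0 <_) U+U+c≡b (≤-trans 0<U (≤-trans (m≤m+n U U) (m≤m+n (U + U) c)))

  suc-h≡d*b : suc h ≡ d * b
  suc-h≡d*b = +-cancelʳ-≡ ((V + V) * b) _ _ (begin
    suc (suc (c * a)) + (V + V) * b    ≡⟨ solve (a ∷ b ∷ c ∷ V ∷ []) ⟩
    (1 + b * V) + (1 + b * V) + c * a  ≡⟨ cong (λ k → k + k + c * a) bezout ⟨
    a * U + a * U + c * a              ≡⟨ solve (a ∷ c ∷ U ∷ []) ⟩
    a * (U + U + c)                    ≡⟨ cong (a *_) U+U+c≡b ⟩
    a * b                              ≡⟨ cong (_* b) V+V+d≡a ⟨
    (V + V + d) * b                    ≡⟨ solve (b ∷ d ∷ V ∷ []) ⟩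
    d * b + (V + V) * b                ∎)

  pred-grid : ∀ q j → suc ((c + j) * a + q * b) ≡ h + q * b + j * a
  pred-grid q j = begin
    suc ((c + j) * a + q * b) ≡⟨ solve (a ∷ b ∷ c ∷ q ∷ j ∷ []) ⟩
    suc (c * a) + q * b + j * a ∎

  suc-grid : ∀ q j → suc (h + q * b + j * a) ≡ j * a + (q + d) * b
  suc-grid q j = begin
    suc (suc (c * a) + q * b + j * a)    ≡⟨ solve (a ∷ b ∷ c ∷ q ∷ j ∷ []) ⟩
    j * a + q * b + suc (suc (c * a))    ≡⟨ cong (λ k → j * a + q * b + k) suc-h≡d*b ⟩
    j * a + q * b + d * b                ≡⟨ solve (a ∷ b ∷ d ∷ q ∷ j ∷ []) ⟩
    j * a + (q + d) * b                  ∎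

  grid∉S : ∀ {q j} → q < V → j < U → ¬ (h + q * b + j * a) ∈⟨ a , b ⟩
  grid∉S {q} {j} q<V j<U (l₁ , l₂ , x≡) = <⇒≱ j+U+c<b (≤-trans (m≤n+m b l₁) l₁+b≤j+U+c)
    where
    j+U+c<b : j + U + c < b
    j+U+c<b = subst (j + U + c <_) U+U+c≡b (+-monoˡ-< c (+-monoˡ-< U j<U))

    l₁+b≤j+U+c : l₁ + b ≤ j + U + c
    l₁+b≤j+U+c = coprime-exchange l₁ (j + U + c) coprime 0<b (≤-trans q<V (m≤n+m V l₂)) (begin
      l₁ * a + (l₂ + V) * b                ≡⟨ solve (a ∷ b ∷ V ∷ l₁ ∷ l₂ ∷ []) ⟩
      (l₁ * a + l₂ * b) + V * b            ≡⟨ cong (_+ V * b) x≡ ⟨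
      suc (c * a) + q * b + j * a + V * b  ≡⟨ solve (a ∷ b ∷ c ∷ V ∷ q ∷ j ∷ []) ⟩
      c * a + q * b + j * a + (1 + b * V)  ≡⟨ cong (λ k → c * a + q * b + j * a + k) bezout ⟨
      c * a + q * b + j * a + a * U        ≡⟨ solve (a ∷ b ∷ c ∷ U ∷ q ∷ j ∷ []) ⟩
      (j + U + c) * a + q * b              ∎)

  grid-gap : ∀ {q j} → q < V → j < U → IsolatedGap a b (h + q * b + j * a)
  grid-gap {q} {j} q<V j<U =
    grid∉S q<V j<U , (_ , pred-grid q j , c + j , q , refl) , (j , q + d , suc-grid q j)

  V≤q⇒suc∈S : ∀ p q → V ≤ q → suc (p * a + q * b) ∈⟨ a , b ⟩
  V≤q⇒suc∈S p q V≤q with m≤n⇒∃[o]m+o≡n V≤q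
  ... | t , refl = p + U , t , (begin
    suc (p * a + (V + t) * b)    ≡⟨ solve (a ∷ b ∷ V ∷ p ∷ t ∷ []) ⟩
    p * a + t * b + (1 + b * V)  ≡⟨ cong (λ k → p * a + t * b + k) bezout ⟨
    p * a + t * b + a * U        ≡⟨ solve (a ∷ b ∷ U ∷ p ∷ t ∷ []) ⟩
    (p + U) * a + t * b          ∎)

  U≤j⇒suc∈S : ∀ j q → U ≤ j → suc ((c + j) * a + q * b) ∈⟨ a , b ⟩
  U≤j⇒suc∈S j q U≤j with m≤n⇒∃[o]m+o≡n U≤j
  ... | t , refl = t , q + V + d , +-cancelʳ-≡ (V * b) _ _ (begin
    suc ((c + (U + t)) * a + q * b) + V * b  ≡⟨ solve (a ∷ b ∷ c ∷ U ∷ V ∷ q ∷ t ∷ []) ⟩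
    (c + U + t) * a + q * b + (1 + b * V)    ≡⟨ cong (λ k → (c + U + t) * a + q * b + k) bezout ⟨
    (c + U + t) * a + q * b + a * U          ≡⟨ solve (a ∷ b ∷ c ∷ U ∷ q ∷ t ∷ []) ⟩
    t * a + q * b + a * (U + U + c)          ≡⟨ cong (λ k → t * a + q * b + a * k) U+U+c≡b ⟩
    t * a + q * b + a * b                    ≡⟨ cong (λ k → t * a + q * b + k * b) V+V+d≡a ⟨
    t * a + q * b + (V + V + d) * b          ≡⟨ solve (b ∷ d ∷ V ∷ q ∷ t ∷ a ∷ []) ⟩
    t * a + (q + V + d) * b + V * b          ∎)

  suc²∈S⇒c≤p : ∀ p {q} → q < V → suc (suc (p * a + q * b)) ∈⟨ a , b ⟩ → c ≤ p
  suc²∈S⇒c≤p p {q} q<V (r , s , x+1≡) =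
    +-cancelˡ-≤ (U + U) c p (subst (_≤ U + U + p) (sym U+U+c≡b) (≤-trans (m≤n+m b r) r+b≤U+U+p))
    where
    r+b≤U+U+p : r + b ≤ U + U + p
    r+b≤U+U+p = coprime-exchange r (U + U + p) coprime 0<b (≤-trans q<V (m≤n+m V (s + V))) (begin
      r * a + (s + V + V) * b                        ≡⟨ solve (a ∷ b ∷ V ∷ r ∷ s ∷ []) ⟩
      (r * a + s * b) + (V * b + V * b)              ≡⟨ cong (_+ (V * b + V * b)) x+1≡ ⟨
      suc (suc (p * a + q * b)) + (V * b + V * b)    ≡⟨ solve (a ∷ b ∷ V ∷ p ∷ q ∷ []) ⟩
      p * a + q * b + (1 + b * V) + (1 + b * V)      ≡⟨ cong (λ k → p * a + q * b + k + k) bezout ⟨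
      p * a + q * b + a * U + a * U                  ≡⟨ solve (a ∷ b ∷ U ∷ p ∷ q ∷ []) ⟩
      (U + U + p) * a + q * b                        ∎)

  gap⇒grid : ∀ {x} → IsolatedGap a b x → Grid a b h V U x
  gap⇒grid (x∉S , (_ , refl , p , q , refl) , x+1∈S)
    with q<V ← ≰⇒> (x∉S ∘ V≤q⇒suc∈S p q)
    with j , refl ← m≤n⇒∃[o]m+o≡n (suc²∈S⇒c≤p p q<V x+1∈S)
    = suc q , suc j , (z<s , q<V) , (z<s , ≰⇒> (x∉S ∘ U≤j⇒suc∈S j q)) , pred-grid q j

  grid⇒gap : ∀ {x} → Grid a b h V U x → IsolatedGap a b x
  grid⇒gap (suc q , suc j , (_ , q<V) , (_ , j<U) , refl) = grid-gap q<V j<U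

  isolatedGaps : IsolatedGapsGrid a b V U
  isolatedGaps = h , (h-gap , λ x → h≤grid ∘ gap⇒grid) , λ x → mk⇔ gap⇒grid grid⇒gap
    where
    h-gap : IsolatedGap a b h
    h-gap = subst (IsolatedGap a b) (trans (+-identityʳ (h + 0)) (+-identityʳ h)) (grid-gap 0<V 0<U)

    h≤grid : ∀ {x} → Grid a b h V U x → h ≤ x
    h≤grid (_ , _ , _ , _ , refl) = ≤-trans (m≤m+n h _) (m≤m+n _ _)

-- (U , -V) is a definitely least solution of a x + b y = 1, in the form |u| ≤ b/2, |v| ≤ a/2.
LeastSolutionℕ : (a b U V : ℕ) → Set
LeastSolutionℕ a b U V = a * U ≡ 1 + b * V × U + U ≤ b × V + V ≤ a

bezout⇒0<U : ∀ {a b U V} → a * U ≡ 1 + b * V → 0 < U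
bezout⇒0<U {a} {U = zero}  aU≡1+bV = contradiction (trans (sym (*-zeroʳ a)) aU≡1+bV) 0≢1+n
bezout⇒0<U {U = suc _} _       = z<s

bezout⇒0<V : ∀ {a b U V} → 1 < a → a * U ≡ 1 + b * V → 0 < V
bezout⇒0<V {a} {b} {U} {zero} 1<a aU≡1+bV =
  contradiction (m*n≡1⇒m≡1 a U (trans aU≡1+bV (cong suc (*-zeroʳ b)))) (>⇒≢ 1<a)
bezout⇒0<V {V = suc _} _ _ = z<s

leastSolution⇒isolatedGaps : ∀ {a b U V} → Coprime a b → 1 < a → LeastSolutionℕ a b U V →
                             IsolatedGapsGrid a b V U
leastSolution⇒isolatedGaps {a} {b} {U} {V} coprime 1<a (bezout , U+U≤b , V+V≤a) =
  IsolatedGapsOfLeastSolution.isolatedGaps coprime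
    (bezout⇒0<U {a} {b} bezout) (bezout⇒0<V {a} {b} {U} 1<a bezout)
    bezout (m+[n∸m]≡n U+U≤b) (m+[n∸m]≡n V+V≤a)

IsDefinitelyLeast-comm : ∀ {a b u v} → IsDefinitelyLeast a b u v → IsDefinitelyLeast b a v u
IsDefinitelyLeast-comm {a} {b} {u} {v} (sol , least) =
  trans (ℤP.+-comm (+ b ℤ.* v) (+ a ℤ.* u)) sol ,
  λ u′ v′ sol′ → swap (least v′ u′ (trans (ℤP.+-comm (+ a ℤ.* v′) (+ b ℤ.* u′)) sol′))

nonneg-nonsolution : ∀ {a b U V} → 1 < a → 1 < b → ¬ IsSolution a b (+ U) (+ V)
nonneg-nonsolution {a} {b} {U} {V} 1<a 1<b sol = no-ℕ-solution U V aU+bV≡1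
  where
  aU+bV≡1 : a * U + b * V ≡ 1
  aU+bV≡1 = ℤP.+-injective (trans (cong₂ ℤ._+_ (ℤP.pos-* a U) (ℤP.pos-* b V)) sol)

  no-ℕ-solution : ∀ U V → a * U + b * V ≢ 1
  no-ℕ-solution (suc U) V eq =
    <⇒≱ 1<a (≤-trans (m≤m*n a (suc U)) (subst (a * suc U ≤_) eq (m≤m+n _ _)))
  no-ℕ-solution zero (suc V) eq =
    <⇒≱ 1<b (≤-trans (m≤m*n b (suc V)) (subst (b * suc V ≤_) eq (m≤n+m _ _)))
  no-ℕ-solution zero zero eq =
    0≢1+n (trans (sym (cong₂ _+_ (*-zeroʳ a) (*-zeroʳ b))) eq)

nonpos-nonsolution : ∀ {a b U V} → ¬ IsSolution a b (ℤ.- + U) (ℤ.- + V)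
nonpos-nonsolution {a} {b} {U} {V} sol = -n≢1 (begin
  ℤ.- + (a * U + b * V)                      ≡⟨ cong ℤ.-_ (cong₂ ℤ._+_ (ℤP.pos-* a U) (ℤP.pos-* b V)) ⟩
  ℤ.- (+ a ℤ.* + U ℤ.+ + b ℤ.* + V)           ≡⟨ negate (+ a) (+ U) (+ b) (+ V) ⟩
  + a ℤ.* ℤ.- + U ℤ.+ + b ℤ.* ℤ.- + V         ≡⟨ sol ⟩
  + 1                                         ∎)
  where
  negate : ∀ x y z w → ℤ.- (x ℤ.* y ℤ.+ z ℤ.* w) ≡ x ℤ.* ℤ.- y ℤ.+ z ℤ.* ℤ.- w
  negate = ℤ-Solver.solve-∀

  -n≢1 : ∀ {n} → ℤ.- + n ≢ + 1
  -n≢1 {zero}  ()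
  -n≢1 {suc _} ()

pos-neg-solution : ∀ {a b U V} → IsSolution a b (+ U) (ℤ.- + V) → a * U ≡ 1 + b * V
pos-neg-solution {a} {b} {U} {V} sol = ℤP.+-injective (begin
  + (a * U)                                            ≡⟨ ℤP.pos-* a U ⟩
  + a ℤ.* + U                                          ≡⟨ shift (+ a ℤ.* + U) (+ b) (+ V) ⟩
  (+ a ℤ.* + U ℤ.+ + b ℤ.* ℤ.- + V) ℤ.+ + b ℤ.* + V    ≡⟨ cong₂ ℤ._+_ sol (sym (ℤP.pos-* b V)) ⟩
  + 1 ℤ.+ + (b * V)                                    ∎)
  where
  shift : ∀ x y z → x ≡ (x ℤ.+ y ℤ.* ℤ.- z) ℤ.+ y ℤ.* z
  shift = ℤ-Solver.solve-∀

≤∣m⊖n∣⇒m+m≤n : ∀ {m n} → 0 < n → m ≤ ∣ m ⊖ n ∣ → m + m ≤ n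
≤∣m⊖n∣⇒m+m≤n {m} {n} 0<n m≤∣m⊖n∣ with m ≤? n
... | yes m≤n = m≤o∸n⇒m+n≤o m m≤n (subst (m ≤_) (ℤP.∣⊖∣-≤ m≤n) m≤∣m⊖n∣)
... | no m≰n  = contradiction (subst (m ≤_) ∣m⊖n∣≡m∸n m≤∣m⊖n∣) (<⇒≱ (∸-monoʳ-< 0<n (<⇒≤ n<m)))
  where
  n<m : n < m
  n<m = ≰⇒> m≰n

  ∣m⊖n∣≡m∸n : ∣ m ⊖ n ∣ ≡ m ∸ n
  ∣m⊖n∣≡m∸n = trans (ℤP.∣m⊖n∣≡∣n⊖m∣ m n) (ℤP.∣⊖∣-< n<m)

pos-neg-least : ∀ {a b U V} → 0 < a → 0 < b →
                IsDefinitelyLeast a b (+ U) -[1+ V ] → LeastSolutionℕ a b U (suc V)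
pos-neg-least {a} {b} {U} {V} 0<a 0<b (sol , least) =
  pos-neg-solution {a} {b} {U} {suc V} sol ,
  ≤∣m⊖n∣⇒m+m≤n 0<b (subst (U ≤_) (cong ∣_∣ (ℤP.m-n≡m⊖n U b)) (proj₁ bounds)) ,
  ≤∣m⊖n∣⇒m+m≤n 0<a (subst (suc V ≤_) ∣a-[1+V]∣≡∣[1+V]⊖a∣ (proj₂ bounds))
  where
  shifted : IsSolution a b (+ U ℤ.- + b) (+ a ℤ.- + suc V)
  shifted = trans (exchange (+ a) (+ U) (+ b) (+ suc V)) sol
    where
    exchange : ∀ x y z w → x ℤ.* (y ℤ.- z) ℤ.+ z ℤ.* (x ℤ.- w) ≡ x ℤ.* y ℤ.+ z ℤ.* ℤ.- w
    exchange = ℤ-Solver.solve-∀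

  bounds : U ≤ ∣ + U ℤ.- + b ∣ × suc V ≤ ∣ + a ℤ.- + suc V ∣
  bounds = least _ _ shifted

  ∣a-[1+V]∣≡∣[1+V]⊖a∣ : ∣ + a ℤ.- + suc V ∣ ≡ ∣ suc V ⊖ a ∣
  ∣a-[1+V]∣≡∣[1+V]⊖a∣ = trans (cong ∣_∣ (ℤP.m-n≡m⊖n a (suc V))) (ℤP.∣m⊖n∣≡∣n⊖m∣ a (suc V))

definitelyLeast⇒ℕ : ∀ {a b u v} → 1 < a → 1 < b → IsDefinitelyLeast a b u v →
                    LeastSolutionℕ a b (∣ u ∣) (∣ v ∣) ⊎ LeastSolutionℕ b a (∣ v ∣) (∣ u ∣)
definitelyLeast⇒ℕ {a} {b} {+ U}      { + V }      1<a 1<b (sol , _) =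
  contradiction sol (nonneg-nonsolution {a} {b} 1<a 1<b)
definitelyLeast⇒ℕ {a} {b} { -[1+ U ] } { -[1+ V ] } _   _   (sol , _) =
  contradiction sol (nonpos-nonsolution {a} {b} {suc U} {suc V})
definitelyLeast⇒ℕ {a} {b} {+ U}      { -[1+ V ] } 1<a 1<b least =
  inj₁ (pos-neg-least {a} {b} (<-trans z<s 1<a) (<-trans z<s 1<b) least)
definitelyLeast⇒ℕ {a} {b} { -[1+ U ] } { + V }      1<a 1<b least =
  inj₂ (pos-neg-least {b} {a} (<-trans z<s 1<b) (<-trans z<s 1<a) (IsDefinitelyLeast-comm {a} {b} least))

theorem4p8 : (a b : ℕ) → Coprime a b → 1 < a → a < b →
    (u v : ℤ) → IsDefinitelyLeast a b u v →
    Σ ℕ λ h → IsMinIsolatedGap a b h ×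
      (∀ x → IsolatedGap a b x ⇔
        (∃ λ i → ∃ λ j → (1 ≤ i × i ≤ ∣ v ∣) × (1 ≤ j × j ≤ ∣ u ∣) ×
          x ≡ h + (i ∸ 1) * b + (j ∸ 1) * a))
theorem4p8 a b coprime 1<a a<b u v least =
  [ leastSolution⇒isolatedGaps coprime 1<a
  , IsolatedGapsGrid-comm ∘ leastSolution⇒isolatedGaps (Coprime.sym coprime) 1<b
  ]′ (definitelyLeast⇒ℕ 1<a 1<b least)
  where
  1<b : 1 < b
  1<b = <-trans 1<a a<b
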